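{- Let $A,B$ be finite alphabets, $\phi:A^*\to B^*$ a coding and $\sigma:A^*\to A^*$ a substitution prolongable on $a\in A$ such that every letter of $A$ has a growth type with respect to $\sigma$, with growth rate $\alpha$ of $\sigma$. Let $y=\sigma^\infty(a)$, suppose every letter of $A$ occurs in $y$, and suppose $x=\phi(y)$ is uniformly recurrent and not ultimately periodic. Let $K\ge 1$ be an integer such that $x$ is linearly recurrent for the constant $K$, and let $Q_\sigma$ be a constant such that $|\sigma^k|\le Q_\sigma\langle\sigma^k\rangle$ for all $k\ge 0$. Then for every $u\in\mathcal{L}(x)$, $$\#\big(\phi^{ -1}(\{u\})\cap \mathcal{L}(y)\big)\le p_\sigma(K+1)\,|\sigma|\,Q_\sigma\,(K+1)^2 .$$
   Context: A coding is a morphism with $\phi(A)=B$. A substitution is a growing endomorphism ($\min_b|\sigma^n(b)|\to\infty$) prolongable on $a$ ($\sigma(a)=au$, $u$ nonempty); $\sigma^\infty(a)$ is the limit of $\sigma^n(a)$. A letter $b$ has growth type $(d,\theta)$ if $|\sigma^n(b)|/(c\,n^d\theta^n)\to1$ for some constant $c$; the growth rate of $\sigma$ is the largest such $\theta$ over letters. $|\tau|=\max_{b}|\tau(b)|$, $\langle\tau\rangle=\min_b|\tau(b)|$. $\mathcal{L}(z)$ is the set of factors of a sequence $z$; $\mathcal L(\sigma)$ is the set of words occurring in some $\sigma^n(b)$, $b\in A$, and $p_\sigma(n)$ is the number of words of length $n$ in $\mathcal{L}(\sigma)$. A sequence $x$ is linearly recurrent for the constant $K$ if it is uniformly recurrent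 and the difference between two successive occurrences of any factor $w$ is at most $K|w|$. Ultimately periodic means of the form $uv^\infty$ with $v$ nonempty. -}

module Defs where

open import Data.Nat as ℕ using (ℕ; zero; suc; _+_; _≤_; _<_; _⊔_; _⊓_)
open import Data.Fin using (Fin)
open import Data.List using (List; []; _∷_; _++_; length; map; concatMap; upTo; allFin; foldr)
open import Data.List.Membership.Propositional using (_∈_)
open import Data.List.Relation.Unary.Unique.Propositional using (Unique)
open import Data.Integer using (+_)
open import Data.Rational as ℚ using (ℚ; _/_)
open import Data.Product using (Σ; ∃; ∃-syntax; _×_; _,_)
open import Relation.Binary.PropositionalEquality using (_≡_; _≢_)
open import Relation.Nullary using (¬_)
open import Function.Bundles using (_⇔_)

Word : ℕ → Set
Word m = List (Fin m)

-- A morphism A* → B* is determined by the images of the letters.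
Morphism : ℕ → ℕ → Set
Morphism m l = Fin m → Word l

_⋆_ : ∀ {m l} → Morphism m l → Word m → Word l
σ ⋆ w = concatMap σ w

iter : ∀ {m} → Morphism m m → ℕ → Word m → Word m
iter σ zero    w = w
iter σ (suc n) w = σ ⋆ iter σ n w

_^[_] : ∀ {m} → Morphism m m → ℕ → Morphism m m
(σ ^[ n ]) b = iter σ n (b ∷ [])

-- |τ| = max_b |τ(b)| and ⟨τ⟩ = min_b |τ(b)| (alphabet Fin (suc m) is nonempty)
maxLen : ∀ {m l} → Morphism (suc m) l → ℕ
maxLen {m} τ = foldr (λ b r → length (τ b) ⊔ r) 0 (allFin (suc m))

minLen : ∀ {m l} → Morphism (suc m) l → ℕ
minLen {m} τ = foldr (λ b r → length (τ b) ⊓ r) (length (τ Fin.zero)) (allFin (suc m))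
  where import Data.Fin as Fin

IsCoding : ∀ {m l} → Morphism m l → Set
IsCoding {m} {l} φ =
  (∀ b → ∃[ c ] φ b ≡ c ∷ []) × (∀ (c : Fin l) → ∃[ b ] φ b ≡ c ∷ [])

IsGrowing : ∀ {m} → Morphism m m → Set
IsGrowing σ = ∀ N → ∃[ n₀ ] ∀ n → n₀ ≤ n → ∀ b → N ≤ length ((σ ^[ n ]) b)

IsProlongable : ∀ {m} → Morphism m m → Fin m → Set
IsProlongable σ a = ∃[ u ] (u ≢ [] × σ a ≡ a ∷ u)

IsSubstitution : ∀ {m} → Morphism m m → Fin m → Set
IsSubstitution σ a = IsGrowing σ × IsProlongable σ a

-- y = σ^∞(a): the infinite sequence having every σ^n(a) as a prefix
IsFixedPointLimit : ∀ {m} → Morphism m m → Fin m → (ℕ → Fin m) → Set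
IsFixedPointLimit σ a y =
  ∀ n i → i < length ((σ ^[ n ]) a) →
    ∃[ p ] ∃[ s ] ((σ ^[ n ]) a ≡ p ++ (y i ∷ s) × length p ≡ i)

ε[_] : ℕ → ℚ
ε[ k ] = + 1 / suc k

IsCauchy : (ℕ → ℚ) → Set
IsCauchy f = ∀ k → ∃[ M ] ∀ i j → M ≤ i → M ≤ j → ℚ.∣ f i ℚ.- f j ∣ ℚ.≤ ε[ k ]

fromℕℚ : ℕ → ℚ
fromℕℚ n = + n / 1

_^ℚ_ : ℚ → ℕ → ℚ
q ^ℚ zero  = ℚ.1ℚ
q ^ℚ suc n = q ℚ.* (q ^ℚ n)

-- Letter b has growth type (d, θ) with constant c, where the reals θ, c
-- are the limits of the Cauchy sequences θs, cs:
--   |σ^n(b)| / (c n^d θ^n) → 1.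
-- Spelled out: for all ε > 0 there is N such that for every n ≥ N,
-- (1-ε) c n^d θ^n ≤ |σ^n(b)| ≤ (1+ε) c n^d θ^n, where the real quantity
-- c n^d θ^n is approached by the rational approximations cs j n^d θs j ^ n.
HasGrowthTypeWith : ∀ {m} → Morphism m m → Fin m → ℕ → (ℕ → ℚ) → (ℕ → ℚ) → Set
HasGrowthTypeWith σ b d θs cs =
  IsCauchy θs × IsCauchy cs ×
  (∀ k → ∃[ N ] ∀ n → N ≤ n → ∃[ J ] ∀ j → J ≤ j →
     let approx = cs j ℚ.* ((fromℕℚ n ^ℚ d) ℚ.* (θs j ^ℚ n))
         len    = fromℕℚ (length ((σ ^[ n ]) b))
     in ((ℚ.1ℚ ℚ.- ε[ k ]) ℚ.* approx ℚ.≤ len) × (len ℚ.≤ (ℚ.1ℚ ℚ.+ ε[ k ]) ℚ.* approx))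

HasGrowthType : ∀ {m} → Morphism m m → Fin m → Set
HasGrowthType σ b = ∃[ d ] ∃[ θs ] ∃[ cs ] HasGrowthTypeWith σ b d θs cs

window : ∀ {m} → (ℕ → Fin m) → ℕ → ℕ → Word m
window z i n = map (λ j → z (i + j)) (upTo n)

OccursAt : ∀ {m} → (ℕ → Fin m) → Word m → ℕ → Set
OccursAt z w i = window z i (length w) ≡ w

Lang : ∀ {m} → (ℕ → Fin m) → Word m → Set
Lang z w = ∃[ i ] OccursAt z w i

IsFactorOf : ∀ {m} → Word m → Word m → Set
IsFactorOf w v = ∃[ p ] ∃[ s ] p ++ w ++ s ≡ v

LangSub : ∀ {m} → Morphism m m → Word m → Set
LangSub σ w = ∃[ n ] ∃[ b ] IsFactorOf w ((σ ^[ n ]) b)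

IsCard : ∀ {m} → (Word m → Set) → ℕ → Set
IsCard {m} P k = ∃[ ws ] (Unique ws × (∀ w → (w ∈ ws) ⇔ P w) × length ws ≡ k)

IsComplexity : ∀ {m} → Morphism m m → ℕ → ℕ → Set
IsComplexity σ n k = IsCard (λ w → length w ≡ n × LangSub σ w) k

IsUniformlyRecurrent : ∀ {m} → (ℕ → Fin m) → Set
IsUniformlyRecurrent z =
  ∀ w → Lang z w → ∃[ R ] ∀ i → ∃[ j ] (i ≤ j × j ≤ i + R × OccursAt z w j)

IsLinearlyRecurrent : ∀ {m} → (ℕ → Fin m) → ℕ → Set
IsLinearlyRecurrent z K =
  IsUniformlyRecurrent z ×
  (∀ w → w ≢ [] → ∀ i → OccursAt z w i →
     ∃[ j ] (i < j × j ≤ i + K ℕ.* length w × OccursAt z w j))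

IsUltimatelyPeriodic : ∀ {m} → (ℕ → Fin m) → Set
IsUltimatelyPeriodic z = ∃[ p ] ∃[ N ] (0 < p × (∀ i → N ≤ i → z (i + p) ≡ z i))

module Submission where

-- Let n = |u|, k least with ⟨σ^k⟩ > n, and h a block
-- length with n ≤ 2Kh and K(d+1) ≤ n for 1 ≤ d < h.
--  * Covering: a preimage occurring in y lies inside σ^k(w) for a factor w of y of
--    length K+1 (the blocks σ^k(y_r) are longer than n), at an offset below |σ^k|.
--  * Spacing: two such offsets in one σ^k(w) are occurrences of u in x at some
--    distance d; linear recurrence and aperiodicity bound periodic runs, giving
--    n < K(d+1), so d ≥ h and σ^k(w) carries at most ⌊|σ^k|/h⌋ + 1 of them.
--  * Estimate: by minimality of k, |σ^k| ≤ |σ| Q ⟨σ^{k-1}⟩ ≤ |σ| Q n ≤ |σ| Q 2Kh.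

open import Defs
open import Data.Nat as ℕ
  using (ℕ; zero; suc; _+_; _*_; _∸_; _≤_; _<_; z≤n; s≤s; _⊔_; _⊓_; _≤?_; NonZero)
open import Data.Nat.Properties
open import Data.Nat.DivMod using (_/_; _%_; m≡m%n+[m/n]*n; m%n<n; m/n*n≤m; m/n≤m; /-monoˡ-≤; m≥n⇒m/n>0)
open import Data.Nat.Tactic.RingSolver using (solve-∀)
open import Algebra.Properties.CommutativeSemigroup +-commutativeSemigroup using (xy∙z≈xz∙y)
open import Data.Fin using (Fin)
open import Data.Fin.Properties using () renaming (_≟_ to _≟ᶠ_)
open import Data.List
  using (List; []; _∷_; _++_; length; map; concatMap; upTo; applyUpTo; allFin; foldr; take; drop; filter)
open import Data.List.Properties
  using (length-++; ++-assoc; ∷-injectiveˡ; ∷-injectiveʳ; map-applyUpTo; concatMap-++; length-map; length-upTo; ≡-dec)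
open import Data.List.Membership.Propositional using (_∈_)
open import Data.List.Membership.Propositional.Properties
  using (∈-++⁻; ∈-++⁺ˡ; ∈-++⁺ʳ; ∈-∃++; ∈-allFin; ∈-filter⁺; ∈-filter⁻; ∈-upTo⁺; ∈-upTo⁻; ∈-map⁺; ∈-concatMap⁺)
open import Data.List.Relation.Unary.Any as Any using (here; there)
open import Data.List.Relation.Unary.All using () renaming (lookup to All-lookup)
open import Data.List.Relation.Unary.AllPairs using (_∷_)
open import Data.List.Relation.Unary.Unique.Propositional using (Unique)
open import Data.List.Relation.Unary.Unique.Propositional.Properties using (filter⁺; upTo⁺)
open import Data.Product using (∃-syntax; _×_; _,_; proj₁; proj₂)
open import Data.Sum using (_⊎_; inj₁; inj₂)
open import Data.Empty using (⊥-elim)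
open import Function.Bundles using (Equivalence)
open import Relation.Binary.Definitions using (tri<; tri≈; tri>)
open import Relation.Binary.PropositionalEquality
open import Relation.Nullary using (¬_; ¬?; yes; no; Dec)
open import Relation.Nullary.Decidable using (decidable-stable)
open import Data.Rational as ℚ using (ℚ)
import Data.Rational.Properties as ℚP

segment : ∀ {A : Set} → (ℕ → A) → ℕ → ℕ → List A
segment z i zero    = []
segment z i (suc L) = z i ∷ segment z (suc i) L

module _ {A : Set} (z : ℕ → A) where

  length-segment : ∀ i L → length (segment z i L) ≡ L
  length-segment i zero    = refl
  length-segment i (suc L) = cong suc (length-segment (suc i) L)

  segment-++ : ∀ i L L' → segment z i (L + L') ≡ segment z i L ++ segment z (i + L) L'
  segment-++ i zero    L' = cong (λ j → segment z j L') (sym (+-identityʳ i))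
  segment-++ i (suc L) L' = cong (z i ∷_) (trans (segment-++ (suc i) L L')
    (cong (λ j → segment z (suc i) L ++ segment z j L') (sym (+-suc i L))))

  applyUpTo-segment : ∀ (f : ℕ → A) i L → (∀ j → f j ≡ z (i + j)) → applyUpTo f L ≡ segment z i L
  applyUpTo-segment f i zero    f≗ = refl
  applyUpTo-segment f i (suc L) f≗ = cong₂ _∷_ (trans (f≗ 0) (cong z (+-identityʳ i)))
    (applyUpTo-segment (λ j → f (suc j)) (suc i) L (λ j → trans (f≗ (suc j)) (cong z (+-suc i j))))

  segment-lookup : ∀ i j L → segment z i L ≡ segment z j L → ∀ t → t < L → z (i + t) ≡ z (j + t)
  segment-lookup i j (suc L) eq zero    _ =
    trans (cong z (+-identityʳ i)) (trans (∷-injectiveˡ eq) (cong z (sym (+-identityʳ j))))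
  segment-lookup i j (suc L) eq (suc t) (s≤s t<L) =
    trans (cong z (+-suc i t)) (trans (segment-lookup (suc i) (suc j) L (∷-injectiveʳ eq) t t<L)
      (cong z (sym (+-suc j t))))

  drop-segment : ∀ i o L → drop o (segment z i L) ≡ segment z (i + o) (L ∸ o)
  drop-segment i zero    L       = cong (λ j → segment z j L) (sym (+-identityʳ i))
  drop-segment i (suc o) zero    = refl
  drop-segment i (suc o) (suc L) =
    trans (drop-segment (suc i) o L) (cong (λ j → segment z j (L ∸ o)) (sym (+-suc i o)))

  take-segment : ∀ i n L → take n (segment z i L) ≡ segment z i (n ⊓ L)
  take-segment i zero    L       = refl
  take-segment i (suc n) zero    = refl
  take-segment i (suc n) (suc L) = cong (z i ∷_) (take-segment (suc i) n L)

  take-drop-segment : ∀ i o n L → take n (drop o (segment z i L)) ≡ segment z (i + o) (n ⊓ (L ∸ o))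
  take-drop-segment i o n L = trans (cong (take n) (drop-segment i o L)) (take-segment (i + o) n (L ∸ o))

  segment-split : ∀ i (P S : List A) → P ++ S ≡ segment z i (length (P ++ S)) →
                  P ≡ segment z i (length P) × S ≡ segment z (i + length P) (length S)
  segment-split i []      S eq = refl , trans eq (cong (λ j → segment z j (length S)) (sym (+-identityʳ i)))
  segment-split i (c ∷ P) S eq with segment-split (suc i) P S (∷-injectiveʳ eq)
  ... | P≡ , S≡ = cong₂ _∷_ (∷-injectiveˡ eq) P≡
                , trans S≡ (cong (λ j → segment z j (length S)) (sym (+-suc i (length P))))

  segment-infix : ∀ i (p w s : List A) → p ++ w ++ s ≡ segment z i (length (p ++ w ++ s)) →
                  w ≡ segment z (i + length p) (length w)
  segment-infix i p w s eq =
    proj₁ (segment-split (i + length p) w s (proj₂ (segment-split i p (w ++ s) eq)))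

  segment-transport : ∀ {T U : List A} i → T ≡ U → U ≡ segment z i (length U) → T ≡ segment z i (length T)
  segment-transport i refl U≡ = U≡

window≡segment : ∀ {m} (z : ℕ → Fin m) i L → window z i L ≡ segment z i L
window≡segment z i L = trans (map-applyUpTo (λ j → j) (λ j → z (i + j)) L)
                             (applyUpTo-segment z _ i L (λ j → refl))

segment-occurs : ∀ {m} (z : ℕ → Fin m) i L → OccursAt z (segment z i L) i
segment-occurs z i L = trans (cong (window z i) (length-segment z i L)) (window≡segment z i L)

occurs-segment : ∀ {m} (z : ℕ → Fin m) i j L → OccursAt z (segment z i L) j → segment z j L ≡ segment z i L
occurs-segment z i j L occ =
  trans (sym (window≡segment z j L)) (trans (cong (window z j) (sym (length-segment z i L))) occ)

occurrence-segment : ∀ {m} (z : ℕ → Fin m) (w : Word m) q → OccursAt z w q → w ≡ segment z q (length w)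
occurrence-segment z w q occ = trans (sym occ) (window≡segment z q (length w))

pigeonhole : ∀ {A B : Set} (f : A → B) (xs : List A) (ys : List B) → Unique xs →
             (∀ x → x ∈ xs → f x ∈ ys) →
             (∀ x x' → x ∈ xs → x' ∈ xs → f x ≡ f x' → x ≡ x') →
             length xs ≤ length ys
pigeonhole f []       ys _             _    _   = z≤n
pigeonhole f (x ∷ xs) ys (x∉xs ∷ uniq) into inj with ∈-∃++ (into x (here refl))
... | ys₁ , ys₂ , refl = begin
  suc (length xs)                 ≤⟨ s≤s (pigeonhole f xs (ys₁ ++ ys₂) uniq into′ inj′) ⟩
  suc (length (ys₁ ++ ys₂))       ≡⟨ cong suc (length-++ ys₁) ⟩
  suc (length ys₁ + length ys₂)   ≡⟨ sym (+-suc (length ys₁) (length ys₂)) ⟩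
  length ys₁ + length (f x ∷ ys₂) ≡⟨ sym (length-++ ys₁) ⟩
  length (ys₁ ++ f x ∷ ys₂)       ∎
  where
  open ≤-Reasoning
  -- removing f x from the target loses nothing, by injectivity
  into′ : ∀ x' → x' ∈ xs → f x' ∈ ys₁ ++ ys₂
  into′ x' x'∈ with ∈-++⁻ ys₁ (into x' (there x'∈))
  ... | inj₁ in₁           = ∈-++⁺ˡ in₁
  ... | inj₂ (there in₂)   = ∈-++⁺ʳ ys₁ in₂
  ... | inj₂ (here fx'≡fx) = ⊥-elim (All-lookup x∉xs x'∈ (inj x x' (here refl) (there x'∈) (sym fx'≡fx)))
  inj′ : ∀ x₁ x₂ → x₁ ∈ xs → x₂ ∈ xs → f x₁ ≡ f x₂ → x₁ ≡ x₂
  inj′ x₁ x₂ x₁∈ x₂∈ = inj x₁ x₂ (there x₁∈) (there x₂∈)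

length-concatMap-≤ : ∀ {A B : Set} (f : A → List B) (xs : List A) C →
                     (∀ x → x ∈ xs → length (f x) ≤ C) → length (concatMap f xs) ≤ length xs * C
length-concatMap-≤ f []       C bound = z≤n
length-concatMap-≤ f (x ∷ xs) C bound = ≤-trans (≤-reflexive (length-++ (f x)))
  (+-mono-≤ (bound x (here refl)) (length-concatMap-≤ f xs C (λ x' x'∈ → bound x' (there x'∈))))

module _ {P : ℕ → Set} (P? : ∀ k → Dec (P k)) where

  private
    searchBelow : ∀ N → (∀ j → j < N → ¬ P j) ⊎ ∃[ k ] (P k × (∀ j → j < k → ¬ P j))
    searchBelow zero = inj₁ (λ j ())
    searchBelow (suc N) with searchBelow N
    ... | inj₂ least = inj₂ least
    ... | inj₁ none with P? N
    ...   | yes pN = inj₂ (N , pN , none)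
    ...   | no ¬pN = inj₁ λ j j<1+N → case (m≤n⇒m<n∨m≡n (≤-pred j<1+N))
      where
      case : ∀ {j} → j < N ⊎ j ≡ N → ¬ P j
      case (inj₁ j<N)  = none _ j<N
      case (inj₂ refl) = ¬pN

  leastWitness : ∀ N → P N → ∃[ k ] (P k × (∀ j → j < k → ¬ P j))
  leastWitness N pN with searchBelow (suc N)
  ... | inj₁ none  = ⊥-elim (none N ≤-refl pN)
  ... | inj₂ least = least

module _ {m : ℕ} (σ : Morphism m m) where

  iter-[] : ∀ k → iter σ k [] ≡ []
  iter-[] zero    = refl
  iter-[] (suc k) = cong (σ ⋆_) (iter-[] k)

  iter-++ : ∀ k u v → iter σ k (u ++ v) ≡ iter σ k u ++ iter σ k v
  iter-++ zero    u v = refl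
  iter-++ (suc k) u v = trans (cong (σ ⋆_) (iter-++ k u v)) (concatMap-++ σ (iter σ k u) (iter σ k v))

  iter-+ : ∀ j N w → iter σ j (iter σ N w) ≡ iter σ (j + N) w
  iter-+ zero    N w = refl
  iter-+ (suc j) N w = cong (σ ⋆_) (iter-+ j N w)

length-⋆-≤ : ∀ {m l} (τ : Morphism m l) X → (∀ b → length (τ b) ≤ X) → ∀ w → length (τ ⋆ w) ≤ length w * X
length-⋆-≤ τ X bound w = length-concatMap-≤ τ w X (λ b _ → bound b)

module _ {m l : ℕ} (τ : Morphism (suc m) l) where

  private
    len : Fin (suc m) → ℕ
    len b = length (τ b)

    foldMax-ub : ∀ {b} xs → b ∈ xs → len b ≤ foldr (λ c r → len c ⊔ r) 0 xs
    foldMax-ub (c ∷ xs) (here refl) = m≤m⊔n (len c) _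
    foldMax-ub (c ∷ xs) (there b∈)  = ≤-trans (foldMax-ub xs b∈) (m≤n⊔m (len c) _)

    foldMax-lub : ∀ X xs → (∀ b → len b ≤ X) → foldr (λ c r → len c ⊔ r) 0 xs ≤ X
    foldMax-lub X []       bound = z≤n
    foldMax-lub X (c ∷ xs) bound = ⊔-lub (bound c) (foldMax-lub X xs bound)

    foldMin-lb : ∀ {b} d xs → b ∈ xs → foldr (λ c r → len c ⊓ r) d xs ≤ len b
    foldMin-lb d (c ∷ xs) (here refl) = m⊓n≤m (len c) _
    foldMin-lb d (c ∷ xs) (there b∈)  = ≤-trans (m⊓n≤n (len c) _) (foldMin-lb d xs b∈)

    foldMin-glb : ∀ X d xs → (∀ b → X ≤ len b) → X ≤ d → X ≤ foldr (λ c r → len c ⊓ r) d xs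
    foldMin-glb X d []       bound X≤d = X≤d
    foldMin-glb X d (c ∷ xs) bound X≤d = ⊓-glb (bound c) (foldMin-glb X d xs bound X≤d)

  maxLen-ub : ∀ b → length (τ b) ≤ maxLen τ
  maxLen-ub b = foldMax-ub (allFin (suc m)) (∈-allFin b)

  maxLen-lub : ∀ X → (∀ b → length (τ b) ≤ X) → maxLen τ ≤ X
  maxLen-lub X = foldMax-lub X (allFin (suc m))

  minLen-lb : ∀ b → minLen τ ≤ length (τ b)
  minLen-lb b = foldMin-lb _ (allFin (suc m)) (∈-allFin b)

  minLen-glb : ∀ X → (∀ b → X ≤ length (τ b)) → X ≤ minLen τ
  minLen-glb X bound = foldMin-glb X _ (allFin (suc m)) bound (bound Data.Fin.zero)

maxLen-suc : ∀ {m} (σ : Morphism (suc m) (suc m)) k → maxLen (σ ^[ suc k ]) ≤ maxLen (σ ^[ k ]) * maxLen σ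
maxLen-suc σ k = maxLen-lub (σ ^[ suc k ]) _ λ b →
  ≤-trans (length-⋆-≤ σ (maxLen σ) (maxLen-ub σ) ((σ ^[ k ]) b))
          (*-monoˡ-≤ (maxLen σ) (maxLen-ub (σ ^[ k ]) b))

module FixedPoint {m : ℕ} (σ : Morphism (suc m) (suc m)) (a : Fin (suc m)) (growing : IsGrowing σ)
                  (y : ℕ → Fin (suc m)) (fixedPoint : IsFixedPointLimit σ a y) where

  private
    positions-segment : ∀ (L : Word (suc m)) off →
      (∀ i → i < length L → ∃[ p ] ∃[ s ] (L ≡ p ++ (y (off + i) ∷ s) × length p ≡ i)) →
      L ≡ segment y off (length L)
    positions-segment []      off at = refl
    positions-segment (c ∷ L) off at = cong₂ _∷_ head (positions-segment L (suc off) tail)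
      where
      head : c ≡ y off
      head with at 0 (s≤s z≤n)
      ... | [] , s , eq , _ = trans (∷-injectiveˡ eq) (cong y (+-identityʳ off))
      tail : ∀ i → i < length L → ∃[ p ] ∃[ s ] (L ≡ p ++ (y (suc off + i) ∷ s) × length p ≡ i)
      tail i i<L with at (suc i) (s≤s i<L)
      ... | _ ∷ p , s , eq , len =
        p , s , trans (∷-injectiveʳ eq) (cong (λ j → p ++ y j ∷ s) (+-suc off i)) , suc-injective len

  iterate-prefix : ∀ N → (σ ^[ N ]) a ≡ segment y 0 (length ((σ ^[ N ]) a))
  iterate-prefix N = positions-segment _ 0 (fixedPoint N)

  longPrefix : ∀ r → ∃[ N ] r ≤ length ((σ ^[ N ]) a)
  longPrefix r with growing r
  ... | N , large = N , large N ≤-refl a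

  prefix-split : ∀ N r → r ≤ length ((σ ^[ N ]) a) →
                 (σ ^[ N ]) a ≡ segment y 0 r ++ segment y r (length ((σ ^[ N ]) a) ∸ r)
  prefix-split N r r≤ = trans (iterate-prefix N) (trans (cong (segment y 0) (sym (m+[n∸m]≡n r≤)))
                                                       (segment-++ y 0 r _))

  -- σ^j maps prefixes of y to prefixes of y: y[0,r) is a prefix of some σ^N(a),
  -- so σ^j(y[0,r)) is a prefix of σ^{j+N}(a).
  image-prefix : ∀ j r → iter σ j (segment y 0 r) ≡ segment y 0 (length (iter σ j (segment y 0 r)))
  image-prefix j r with longPrefix r
  ... | N , r≤ = proj₁ (segment-split y 0 (iter σ j (segment y 0 r)) (iter σ j (segment y r _)) image)
    where
    split-image : iter σ j (segment y 0 r) ++ iter σ j (segment y r _) ≡ iter σ (j + N) (a ∷ [])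
    split-image = begin
      iter σ j (segment y 0 r) ++ iter σ j (segment y r _) ≡⟨ sym (iter-++ σ j (segment y 0 r) _) ⟩
      iter σ j (segment y 0 r ++ segment y r _)            ≡⟨ cong (iter σ j) (sym (prefix-split N r r≤)) ⟩
      iter σ j (iter σ N (a ∷ []))                         ≡⟨ iter-+ σ j N (a ∷ []) ⟩
      iter σ (j + N) (a ∷ [])                              ∎
      where open ≡-Reasoning
    image = segment-transport y 0 split-image (iterate-prefix (j + N))

  image-factor : ∀ j r L → iter σ j (segment y r L) ≡
                 segment y (length (iter σ j (segment y 0 r))) (length (iter σ j (segment y r L)))
  image-factor j r L = proj₂ (segment-split y 0 (iter σ j (segment y 0 r)) (iter σ j (segment y r L))
    (segment-transport y 0 (sym (trans (cong (iter σ j) (segment-++ y 0 r L)) (iter-++ σ j _ _)))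
                           (image-prefix j (r + L))))

  -- Every factor of y belongs to 𝓛(σ), being a factor of a long prefix σ^N(a).
  factor-inLang : ∀ r L → LangSub σ (segment y r L)
  factor-inLang r L with longPrefix (r + L)
  ... | N , r+L≤ = N , a , segment y 0 r , segment y (r + L) _ , sym (begin
    (σ ^[ N ]) a                                                ≡⟨ prefix-split N (r + L) r+L≤ ⟩
    segment y 0 (r + L) ++ segment y (r + L) _                  ≡⟨ cong (_++ segment y (r + L) _) (segment-++ y 0 r L) ⟩
    (segment y 0 r ++ segment y r L) ++ segment y (r + L) _     ≡⟨ ++-assoc (segment y 0 r) _ _ ⟩
    segment y 0 r ++ segment y r L ++ segment y (r + L) _       ∎)
    where open ≡-Reasoning

  -- When every letter occurs in y, σ^k(w) is a factor of y for every w ∈ 𝓛(σ):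
  -- w is a factor of σ^N(b), and b = y_i, so σ^k(w) is a factor of σ^{k+N}(y_i).
  image-inLang : (∀ b → ∃[ i ] y i ≡ b) → ∀ k w → LangSub σ w →
                 ∃[ P ] iter σ k w ≡ segment y P (length (iter σ k w))
  image-inLang occurs k w (N , b , p , s , w-in) with occurs b
  ... | i , refl = _ , segment-infix y _ (iter σ k p) (iter σ k w) (iter σ k s)
                         (segment-transport y _ images (image-factor (k + N) i 1))
    where
    images : iter σ k p ++ iter σ k w ++ iter σ k s ≡ iter σ (k + N) (segment y i 1)
    images = begin
      iter σ k p ++ iter σ k w ++ iter σ k s ≡⟨ cong (iter σ k p ++_) (sym (iter-++ σ k w s)) ⟩
      iter σ k p ++ iter σ k (w ++ s)        ≡⟨ sym (iter-++ σ k p (w ++ s)) ⟩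
      iter σ k (p ++ w ++ s)                 ≡⟨ cong (iter σ k) w-in ⟩
      iter σ k (iter σ N (y i ∷ []))         ≡⟨ iter-+ σ k N (y i ∷ []) ⟩
      iter σ (k + N) (y i ∷ [])              ∎
      where open ≡-Reasoning

  module Blocks (k : ℕ) where

    start : ℕ → ℕ
    start r = length (iter σ k (segment y 0 r))

    blockLength : ℕ → ℕ
    blockLength r = length ((σ ^[ k ]) (y r))

    start-suc : ∀ r → start (suc r) ≡ start r + blockLength r
    start-suc r = begin
      length (iter σ k (segment y 0 (suc r)))
        ≡⟨ cong (λ L → length (iter σ k (segment y 0 L))) (+-comm 1 r) ⟩
      length (iter σ k (segment y 0 (r + 1)))
        ≡⟨ cong (λ w → length (iter σ k w)) (segment-++ y 0 r 1) ⟩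
      length (iter σ k (segment y 0 r ++ y (0 + r) ∷ []))
        ≡⟨ cong length (iter-++ σ k (segment y 0 r) _) ⟩
      length (iter σ k (segment y 0 r) ++ (σ ^[ k ]) (y r))
        ≡⟨ length-++ (iter σ k (segment y 0 r)) ⟩
      start r + blockLength r ∎
      where open ≡-Reasoning

    locate : 1 ≤ minLen (σ ^[ k ]) → ∀ q → ∃[ r ] (start r ≤ q × q < start (suc r))
    locate nonempty = go
      where
      start-< : ∀ r → start r < start (suc r)
      start-< r = subst (start r <_) (sym (start-suc r))
        (≤-trans (≤-reflexive (+-comm 1 (start r))) (+-monoʳ-≤ (start r) (≤-trans nonempty (minLen-lb (σ ^[ k ]) (y r)))))
      start-0 : start 0 ≡ 0
      start-0 = cong length (iter-[] σ k)
      go : ∀ q → ∃[ r ] (start r ≤ q × q < start (suc r))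
      go zero = 0 , ≤-reflexive start-0 , subst (_< start 1) start-0 (start-< 0)
      go (suc q) with go q
      ... | r , r≤q , q< with suc q ℕ.<? start (suc r)
      ...   | yes q+1< = r , m≤n⇒m≤1+n r≤q , q+1<
      ...   | no  q+1≮ = suc r , ≮⇒≥ q+1≮ , ≤-trans (s≤s q<) (start-< (suc r))

    cover : ∀ n t → suc n ≤ minLen (σ ^[ k ]) → ∀ q →
            ∃[ r ] ∃[ o ] (o < blockLength r × take n (drop o (iter σ k (segment y r (2 + t)))) ≡ segment y q n)
    cover n t long q with locate (≤-trans (s≤s z≤n) long) q
    ... | r , r≤q , q< = r , o , o<block , extract≡
      where
      o = q ∸ start r
      w = segment y r (2 + t)
      L = length (iter σ k w)
      o<block : o < blockLength r
      o<block = +-cancelˡ-< (start r) o (blockLength r)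
        (subst₂ _<_ (sym (m+[n∸m]≡n r≤q)) (start-suc r) q<)
      two-blocks : blockLength r + blockLength (suc r) ≤ L
      two-blocks = begin
        blockLength r + blockLength (suc r) ≤⟨ +-monoʳ-≤ (blockLength r) (m≤m+n _ _) ⟩
        blockLength r + (blockLength (suc r) + length (iter σ k (segment y (2 + r) t)))
          ≡⟨ cong (blockLength r +_) (sym (length-++ ((σ ^[ k ]) (y (suc r))))) ⟩
        blockLength r + length ((σ ^[ k ]) (y (suc r)) ++ iter σ k (segment y (2 + r) t))
          ≡⟨ sym (length-++ ((σ ^[ k ]) (y r))) ⟩
        length ((σ ^[ k ]) (y r) ++ (σ ^[ k ]) (y (suc r)) ++ iter σ k (segment y (2 + r) t))
          ≡⟨ cong length (sym (trans (iter-++ σ k (y r ∷ []) _)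
                                     (cong ((σ ^[ k ]) (y r) ++_) (iter-++ σ k (y (suc r) ∷ []) _)))) ⟩
        L ∎
        where open ≤-Reasoning
      n≤L∸o : n ≤ L ∸ o
      n≤L∸o = ≤-trans (≤-reflexive (sym (m+n∸m≡n o n)))
        (∸-monoˡ-≤ o (≤-trans (+-mono-≤ (<⇒≤ o<block) n≤block) two-blocks))
        where
        n≤block : n ≤ blockLength (suc r)
        n≤block = ≤-trans (n≤1+n n) (≤-trans long (minLen-lb (σ ^[ k ]) (y (suc r))))
      extract≡ : take n (drop o (iter σ k w)) ≡ segment y q n
      extract≡ = begin
        take n (drop o (iter σ k w))                 ≡⟨ cong (λ v → take n (drop o v)) (image-factor k r (2 + t)) ⟩
        take n (drop o (segment y (start r) L))      ≡⟨ take-drop-segment y (start r) o n L ⟩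
        segment y (start r + o) (n ⊓ (L ∸ o))        ≡⟨ cong₂ (segment y) (m+[n∸m]≡n r≤q) (m≤n⇒m⊓n≡m n≤L∸o) ⟩
        segment y q n                                ∎
        where open ≡-Reasoning

module PeriodicRuns {l : ℕ} (x : ℕ → Fin l) (K : ℕ) (linRec : IsLinearlyRecurrent x K)
                    (aperiodic : ¬ IsUltimatelyPeriodic x) where

  PeriodicOn : ℕ → ℕ → ℕ → Set
  PeriodicOn d s E = ∀ t → s ≤ t → t < E → x t ≡ x (t + d)

  periodicOn-intro : ∀ d s L → (∀ j → j < L → x (s + j) ≡ x (s + j + d)) → PeriodicOn d s (s + L)
  periodicOn-intro d s L periodic t s≤t t<E = subst (λ t' → x t' ≡ x (t' + d)) (m+[n∸m]≡n s≤t)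
    (periodic (t ∸ s) (+-cancelˡ-< s _ L (subst (_< s + L) (sym (m+[n∸m]≡n s≤t)) t<E)))

  -- A run [s₀+1, E) of period d preceded by a break at s₀ ends by s₀ + K(d+1): the next
  -- occurrence j of x[s₀, s₀+d] breaks the period at j, so j cannot lie inside the run.
  breakBound : ∀ d s₀ E → PeriodicOn d (suc s₀) E → x s₀ ≢ x (s₀ + d) → E ≤ s₀ + K * suc d
  breakBound d s₀ E run break
    with proj₂ linRec (segment x s₀ (suc d)) (λ ()) s₀ (segment-occurs x s₀ (suc d))
  ... | j , s₀<j , j≤ , occ = ≤-trans (≮⇒≥ j≮E) (subst (λ L → j ≤ s₀ + K * L) (length-segment x s₀ (suc d)) j≤)
    where
    same : ∀ t → t < suc d → x (j + t) ≡ x (s₀ + t)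
    same = segment-lookup x j s₀ (suc d) (occurs-segment x s₀ j (suc d) occ)
    j≮E : ¬ j < E
    j≮E j<E = break (begin
      x s₀       ≡⟨ cong x (sym (+-identityʳ s₀)) ⟩
      x (s₀ + 0) ≡⟨ sym (same 0 (s≤s z≤n)) ⟩
      x (j + 0)  ≡⟨ cong x (+-identityʳ j) ⟩
      x j        ≡⟨ run j s₀<j j<E ⟩
      x (j + d)  ≡⟨ same d ≤-refl ⟩
      x (s₀ + d) ∎)
      where open ≡-Reasoning

  -- Extending a run to the left: either it reaches position 0, or it is preceded by a
  -- break and is therefore short.
  shortOrInitial : ∀ d s E → PeriodicOn d s E → PeriodicOn d 0 E ⊎ suc E ≤ s + K * suc d
  shortOrInitial d zero     E run = inj₁ run
  shortOrInitial d (suc s₀) E run with x s₀ ≟ᶠ x (s₀ + d)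
  ... | no  break = inj₂ (s≤s (breakBound d s₀ E run break))
  ... | yes equal with shortOrInitial d s₀ E extended
    where
    extended : PeriodicOn d s₀ E
    extended t s₀≤t t<E with m≤n⇒m<n∨m≡n s₀≤t
    ... | inj₁ s₀<t = run t s₀<t t<E
    ... | inj₂ refl = equal
  ...   | inj₁ initial = inj₁ initial
  ...   | inj₂ short   = inj₂ (≤-trans short (+-monoˡ-≤ (K * suc d) (n≤1+n s₀)))

  -- If e is the first place where the period d breaks, then e < K(d+1): the prefix
  -- x[0, e+d] recurs at some t₀ > 0, carrying the run [0, e) to [t₀, t₀+e); that run
  -- cannot reach back to 0 (x would have period d at e), so it is short.
  firstBreakBound : ∀ d e → PeriodicOn d 0 e → x e ≢ x (e + d) → suc e ≤ K * suc d
  firstBreakBound d e run break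
    with proj₂ linRec (segment x 0 (e + suc d)) nonempty 0 (segment-occurs x 0 (e + suc d))
    where
    nonempty : segment x 0 (e + suc d) ≢ []
    nonempty eq = 0≢1+n (trans (sym (cong length eq)) (trans (length-segment x 0 _) (+-suc e d)))
  ... | t₀ , 0<t₀ , _ , occ with shortOrInitial d t₀ (t₀ + e) shiftedRun
    where
    shifted : ∀ j → j < e + suc d → x (t₀ + j) ≡ x j
    shifted = segment-lookup x t₀ 0 (e + suc d) (occurs-segment x 0 t₀ (e + suc d) occ)
    shiftedRun : PeriodicOn d t₀ (t₀ + e)
    shiftedRun = periodicOn-intro d t₀ e λ j j<e → begin
      x (t₀ + j)       ≡⟨ shifted j (≤-trans j<e (m≤m+n e (suc d))) ⟩
      x j              ≡⟨ run j z≤n j<e ⟩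
      x (j + d)        ≡⟨ sym (shifted (j + d) (+-mono-< j<e (n<1+n d))) ⟩
      x (t₀ + (j + d)) ≡⟨ cong x (sym (+-assoc t₀ j d)) ⟩
      x (t₀ + j + d)   ∎
      where open ≡-Reasoning
  ... | inj₁ initial = ⊥-elim (break (initial e z≤n (+-monoˡ-≤ e 0<t₀)))
  ... | inj₂ short   = +-cancelˡ-≤ t₀ (suc e) (K * suc d) (subst (_≤ t₀ + K * suc d) (sym (+-suc t₀ e)) short)

  -- The bound is decidable, so we may argue by
  -- contradiction: otherwise x has no break at all (a least break would be far out),
  -- and x would be periodic.
  initialRunBound : ∀ d E → 1 ≤ d → PeriodicOn d 0 E → suc E ≤ K * suc d
  initialRunBound d E d≥1 run = decidable-stable (suc E ≤? K * suc d) λ long →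
    aperiodic (d , 0 , d≥1 , λ i _ → sym (noBreak long i))
    where
    noBreak : ¬ suc E ≤ K * suc d → ∀ i → x i ≡ x (i + d)
    noBreak long i with x i ≟ᶠ x (i + d)
    ... | yes equal = equal
    ... | no  break with leastWitness (λ t → ¬? (x t ≟ᶠ x (t + d))) i break
    ...   | e , break-e , before = ⊥-elim (long (≤-trans (s≤s E≤e) (firstBreakBound d e periodicBefore break-e)))
      where
      periodicBefore : PeriodicOn d 0 e
      periodicBefore t _ t<e = decidable-stable (x t ≟ᶠ x (t + d)) (before t t<e)
      E≤e : E ≤ e
      E≤e = ≮⇒≥ (λ e<E → break-e (run e z≤n e<E))

  -- Two occurrences of a word of length n at distance d ≥ 1 in x force n < K(d+1):
  -- they span a run of period d of length n.
  overlapBound : ∀ n i d → 1 ≤ d → segment x i n ≡ segment x (i + d) n → suc n ≤ K * suc d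
  overlapBound n i d d≥1 eq with shortOrInitial d i (i + n) run
    where
    run : PeriodicOn d i (i + n)
    run = periodicOn-intro d i n λ j j<n →
      trans (segment-lookup x i (i + d) n eq j j<n) (cong x (xy∙z≈xz∙y i d j))
  ... | inj₁ initial = ≤-trans (s≤s (m≤n+m n i)) (initialRunBound d (i + n) d≥1 initial)
  ... | inj₂ short   = +-cancelˡ-≤ i (suc n) (K * suc d) (subst (_≤ i + K * suc d) (sym (+-suc i n)) short)

-- For n and K ≥ 1 there is h ≥ 1 with n ≤ 2Kh such that K(d+1) ≤ n whenever
-- 1 ≤ d < h; namely h = max(1, ⌊n/K⌋).
spacingLength : ∀ n K' → let K = suc K' in
  ∃[ h' ] (n ≤ K * suc h' + K * suc h' × (∀ d → 1 ≤ d → d < suc h' → K * suc d ≤ n))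
spacingLength n K' with suc K' ≤? n
... | no  n<K = 0 , ≤-trans (<⇒≤ (≰⇒> n<K)) (≤-trans (≤-reflexive (sym (*-identityʳ (suc K')))) (m≤m+n _ _))
              , λ { d (s≤s z≤n) (s≤s ()) }
... | yes K≤n with n / suc K' in quotient
...   | zero   = ⊥-elim (<-irrefl refl (subst (0 <_) quotient (m≥n⇒m/n>0 {n} {suc K'} K≤n)))
...   | suc h' = h' , n≤2Kh , short
  where
  K = suc K'
  n≤2Kh : n ≤ K * suc h' + K * suc h'
  n≤2Kh = begin
    n                       ≡⟨ m≡m%n+[m/n]*n n K ⟩
    n % K + n / K * K       ≤⟨ +-monoˡ-≤ (n / K * K) (<⇒≤ (m%n<n n K)) ⟩
    K + n / K * K           ≡⟨ cong₂ _+_ (sym (*-identityʳ K)) (trans (cong (_* K) quotient) (*-comm (suc h') K)) ⟩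
    K * 1 + K * suc h'      ≤⟨ +-monoˡ-≤ (K * suc h') (*-monoʳ-≤ K (s≤s z≤n)) ⟩
    K * suc h' + K * suc h' ∎
    where open ≤-Reasoning
  short : ∀ d → 1 ≤ d → d < suc h' → K * suc d ≤ n
  short d _ d<h = begin
    K * suc d   ≤⟨ *-monoʳ-≤ K d<h ⟩
    K * suc h'  ≡⟨ trans (*-comm K (suc h')) (cong (_* K) (sym quotient)) ⟩
    n / K * K   ≤⟨ m/n*n≤m n K ⟩
    n           ∎
    where open ≤-Reasoning

sameQuotient⇒close : ∀ o o' h .{{_ : NonZero h}} → o < o' → o / h ≡ o' / h → o' ∸ o < h
sameQuotient⇒close o o' h o<o' same = ≤-<-trans gap (m%n<n o' h)
  where
  gap : o' ∸ o ≤ o' % h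
  gap = begin
    o' ∸ o                           ≤⟨ ∸-monoʳ-≤ o' (≤-trans (≤-reflexive (cong (_* h) (sym same))) (m/n*n≤m o h)) ⟩
    o' ∸ o' / h * h                  ≡⟨ cong (_∸ o' / h * h) (m≡m%n+[m/n]*n o' h) ⟩
    o' % h + o' / h * h ∸ o' / h * h ≡⟨ m+n∸n≡m (o' % h) (o' / h * h) ⟩
    o' % h                           ∎
    where open ≤-Reasoning

module Embedding where
  open import Data.Integer as ℤ using (+_)
  import Data.Integer.Properties as ℤP
  import Data.Rational.Unnormalised as ℚᵘ
  import Data.Rational.Unnormalised.Properties as ℚᵘP
  open import Data.Nat.Coprimality using (1-coprimeTo) renaming (sym to coprime-sym)
  open import Data.Rational using (1ℚ; NonNegative; Positive; toℚᵘ; mkℚ; *≤*; nonNegative)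

  ⟦_⟧ : ℕ → ℚ
  ⟦ n ⟧ = fromℕℚ n

  private
    ⟦⟧-mkℚ : ∀ n → ⟦ n ⟧ ≡ mkℚ (+ n) 0 (coprime-sym (1-coprimeTo n))
    ⟦⟧-mkℚ n = ℚP.normalize-coprime (coprime-sym (1-coprimeTo n))

  ⟦⟧-mono : ∀ {a b} → a ℕ.≤ b → ⟦ a ⟧ ℚ.≤ ⟦ b ⟧
  ⟦⟧-mono {a} {b} a≤b rewrite ⟦⟧-mkℚ a | ⟦⟧-mkℚ b =
    *≤* (subst₂ ℤ._≤_ (sym (ℤP.*-identityʳ (+ a))) (sym (ℤP.*-identityʳ (+ b))) (ℤ.+≤+ a≤b))

  ⟦⟧-* : ∀ a b → ⟦ a ℕ.* b ⟧ ≡ ⟦ a ⟧ ℚ.* ⟦ b ⟧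
  ⟦⟧-* a b = ℚP.toℚᵘ-injective (ℚᵘP.≃-trans unnormalised (ℚᵘP.≃-sym (ℚP.toℚᵘ-homo-* ⟦ a ⟧ ⟦ b ⟧)))
    where
    unnormalised : toℚᵘ ⟦ a ℕ.* b ⟧ ℚᵘ.≃ (toℚᵘ ⟦ a ⟧ ℚᵘ.* toℚᵘ ⟦ b ⟧)
    unnormalised rewrite ⟦⟧-mkℚ a | ⟦⟧-mkℚ b | ⟦⟧-mkℚ (a ℕ.* b) = ℚᵘ.*≡* (cong (ℤ._* + 1) (ℤP.pos-* a b))

  ⟦⟧-+ : ∀ a b → ⟦ a ℕ.+ b ⟧ ≡ ⟦ a ⟧ ℚ.+ ⟦ b ⟧
  ⟦⟧-+ a b = ℚP.toℚᵘ-injective (ℚᵘP.≃-trans unnormalised (ℚᵘP.≃-sym (ℚP.toℚᵘ-homo-+ ⟦ a ⟧ ⟦ b ⟧)))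
    where
    unnormalised : toℚᵘ ⟦ a ℕ.+ b ⟧ ℚᵘ.≃ (toℚᵘ ⟦ a ⟧ ℚᵘ.+ toℚᵘ ⟦ b ⟧)
    unnormalised rewrite ⟦⟧-mkℚ a | ⟦⟧-mkℚ b | ⟦⟧-mkℚ (a ℕ.+ b) = ℚᵘ.*≡* (cong (ℤ._* + 1)
      (trans (ℤP.pos-+ a b) (sym (cong₂ ℤ._+_ (ℤP.*-identityʳ (+ a)) (ℤP.*-identityʳ (+ b))))))

  ⟦⟧-nonNeg : ∀ n → NonNegative ⟦ n ⟧
  ⟦⟧-nonNeg n = ℚP.normalize-nonNeg n 1

  ⟦suc⟧-pos : ∀ n → Positive ⟦ suc n ⟧
  ⟦suc⟧-pos n = ℚP.normalize-pos (suc n) 1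

  ≥1⇒nonNeg : ∀ {q} → 1ℚ ℚ.≤ q → NonNegative q
  ≥1⇒nonNeg 1≤q = nonNegative (ℚP.≤-trans (⟦⟧-mono {0} {1} z≤n) 1≤q)

  ≤-scale : ∀ {r} q → 1ℚ ℚ.≤ r → NonNegative q → q ℚ.≤ r ℚ.* q
  ≤-scale {r} q 1≤r q≥0 = ℚP.≤-trans (ℚP.≤-reflexive (sym (ℚP.*-identityˡ q))) (ℚP.*-monoʳ-≤-nonNeg q {{q≥0}} 1≤r)

  ≥1-* : ∀ {q r} → 1ℚ ℚ.≤ q → 1ℚ ℚ.≤ r → 1ℚ ℚ.≤ q ℚ.* r
  ≥1-* {q} {r} 1≤q 1≤r = ℚP.≤-trans 1≤q (ℚP.≤-trans (ℚP.≤-reflexive (sym (ℚP.*-identityʳ q)))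
    (ℚP.*-monoˡ-≤-nonNeg q {{≥1⇒nonNeg 1≤q}} 1≤r))

  ≤-suc-scaled : ∀ {r} D T → 1ℚ ℚ.≤ r → ⟦ D ⟧ ℚ.≤ r ℚ.* ⟦ T ⟧ → ⟦ suc D ⟧ ℚ.≤ r ℚ.* ⟦ 1 ℕ.+ T ⟧
  ≤-suc-scaled {r} D T 1≤r D≤ = begin
    ⟦ 1 ℕ.+ D ⟧                ≡⟨ ⟦⟧-+ 1 D ⟩
    1ℚ ℚ.+ ⟦ D ⟧               ≤⟨ ℚP.+-mono-≤ (ℚP.≤-trans 1≤r (ℚP.≤-reflexive (sym (ℚP.*-identityʳ r)))) D≤ ⟩
    r ℚ.* 1ℚ ℚ.+ r ℚ.* ⟦ T ⟧   ≡⟨ sym (ℚP.*-distribˡ-+ r 1ℚ ⟦ T ⟧) ⟩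
    r ℚ.* (1ℚ ℚ.+ ⟦ T ⟧)       ≡⟨ cong (r ℚ.*_) (sym (⟦⟧-+ 1 T)) ⟩
    r ℚ.* ⟦ 1 ℕ.+ T ⟧          ∎
    where open ℚP.≤-Reasoning

length-coding : ∀ {m l} (φ : Morphism m l) → (∀ b → ∃[ c ] φ b ≡ c ∷ []) → ∀ v → length (φ ⋆ v) ≡ length v
length-coding φ letterwise []      = refl
length-coding φ letterwise (b ∷ v) with letterwise b
... | c , φb≡c rewrite φb≡c = cong suc (length-coding φ letterwise v)

coding-segment : ∀ {m l} (φ : Morphism m l) (y : ℕ → Fin m) (x : ℕ → Fin l) →
                 (∀ i → φ (y i) ≡ x i ∷ []) → ∀ i L → φ ⋆ segment y i L ≡ segment x i L
coding-segment φ y x x≡φy i zero    = refl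
coding-segment φ y x x≡φy i (suc L) rewrite x≡φy i = cong (x i ∷_) (coding-segment φ y x x≡φy (suc i) L)

module Counting {m l : ℕ} (φ : Morphism (suc m) l) (σ : Morphism (suc m) (suc m)) (a : Fin (suc m))
  (letterwise : ∀ b → ∃[ c ] φ b ≡ c ∷ []) (growing : IsGrowing σ)
  (y : ℕ → Fin (suc m)) (fixedPoint : IsFixedPointLimit σ a y) (occurs : ∀ b → ∃[ i ] y i ≡ b)
  (x : ℕ → Fin l) (x≡φy : ∀ i → φ (y i) ≡ x i ∷ []) (aperiodic : ¬ IsUltimatelyPeriodic x)
  (K' : ℕ) (linRec : IsLinearlyRecurrent x (suc K'))
  (u : Word l) (k : ℕ) (long : suc (length u) ≤ minLen (σ ^[ k ]))
  (h' : ℕ) (spaced : ∀ d → 1 ≤ d → d < suc h' → suc K' * suc d ≤ length u) where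

  open FixedPoint σ a growing y fixedPoint
  open Blocks k
  open PeriodicRuns x (suc K') linRec aperiodic

  private
    K n h M : ℕ
    K = suc K'
    n = length u
    h = suc h'
    M = maxLen (σ ^[ k ])

  extract : Word (suc m) → ℕ → Word (suc m)
  extract w o = take n (drop o (iter σ k w))

  admissible? : ∀ w o → Dec (φ ⋆ extract w o ≡ u)
  admissible? w o = ≡-dec _≟ᶠ_ (φ ⋆ extract w o) u

  offsets : Word (suc m) → List ℕ
  offsets w = filter (admissible? w) (upTo M)

  candidates : List (Word (suc m)) → List (Word (suc m))
  candidates = concatMap (λ w → map (extract w) (offsets w))

  -- Covering: a preimage v of u occurring in y is found in σ^k(w) for the factor w of
  -- length K+1 of y starting at the block where v starts.
  preimage-candidate : ∀ ws → (∀ w → length w ≡ K + 1 → LangSub σ w → w ∈ ws) →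
                       ∀ v → φ ⋆ v ≡ u → Lang y v → v ∈ candidates ws
  preimage-candidate ws complete v φv≡u (q , occ) with cover n K' long q
  ... | r , o , o<block , extract≡ =
    ∈-concatMap⁺ (λ w' → map (extract w') (offsets w'))
      (Any.map (λ { refl → subst (_∈ map (extract w) (offsets w)) extract≡v (∈-map⁺ (extract w) o∈) }) w∈)
    where
    w = segment y r (2 + K')
    w∈ : w ∈ ws
    w∈ = complete w (trans (length-segment y r (2 + K')) (+-comm 1 K)) (factor-inLang r (2 + K'))
    extract≡v : extract w o ≡ v
    extract≡v = trans extract≡ (sym (subst (λ L → v ≡ segment y q L)
      (trans (sym (length-coding φ letterwise v)) (cong length φv≡u)) (occurrence-segment y v q occ)))
    o∈ : o ∈ offsets w
    o∈ = ∈-filter⁺ (admissible? w)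
      (∈-upTo⁺ (≤-trans o<block (maxLen-ub (σ ^[ k ]) (y r)))) (trans (cong (φ ⋆_) extract≡v) φv≡u)

  -- For w ∈ 𝓛(σ), σ^k(w) occurs in y at some position P, so an admissible offset o
  -- yields an occurrence of u in x at position P + o.
  offset-occurrence : ∀ w → (w∈ : LangSub σ w) → ∀ o → o ∈ offsets w →
                      segment x (proj₁ (image-inLang occurs k w w∈) + o) n ≡ u
  offset-occurrence w w∈ o o∈ = begin
    segment x (P + o) n      ≡⟨ sym (coding-segment φ y x x≡φy (P + o) n) ⟩
    φ ⋆ segment y (P + o) n  ≡⟨ cong (φ ⋆_) (sym extract≡) ⟩
    φ ⋆ extract w o          ≡⟨ φextract≡u ⟩
    u                        ∎
    where
    open ≡-Reasoning
    P = proj₁ (image-inLang occurs k w w∈)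
    L = length (iter σ k w)
    φextract≡u : φ ⋆ extract w o ≡ u
    φextract≡u = proj₂ (∈-filter⁻ (admissible? w) {xs = upTo M} o∈)
    extract-segment : extract w o ≡ segment y (P + o) (n ⊓ (L ∸ o))
    extract-segment = trans (cong (λ v → take n (drop o v)) (proj₂ (image-inLang occurs k w w∈)))
                            (take-drop-segment y P o n L)
    full-length : n ⊓ (L ∸ o) ≡ n
    full-length = trans (sym (length-segment y (P + o) _)) (trans (cong length (sym extract-segment))
                  (trans (sym (length-coding φ letterwise (extract w o))) (cong length φextract≡u)))
    extract≡ : extract w o ≡ segment y (P + o) n
    extract≡ = trans extract-segment (cong (segment y (P + o)) full-length)

  -- Spacing: two admissible offsets of σ^k(w) are at least h apart, since two
  -- occurrences of u at distance d force K(d+1) > n.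
  offsets-spaced : ∀ w → LangSub σ w → ∀ o o' → o ∈ offsets w → o' ∈ offsets w → o < o' → o / h ≢ o' / h
  offsets-spaced w w∈ o o' o∈ o'∈ o<o' same = <⇒≱ (overlapBound n (P + o) d 1≤d repeated) (spaced d 1≤d d<h)
    where
    P = proj₁ (image-inLang occurs k w w∈)
    d = o' ∸ o
    1≤d : 1 ≤ d
    1≤d = m<n⇒0<n∸m o<o'
    d<h : d < h
    d<h = sameQuotient⇒close o o' h o<o' same
    repeated : segment x (P + o) n ≡ segment x (P + o + d) n
    repeated = begin
      segment x (P + o) n        ≡⟨ offset-occurrence w w∈ o o∈ ⟩
      u                          ≡⟨ sym (offset-occurrence w w∈ o' o'∈) ⟩
      segment x (P + o') n       ≡⟨ cong (λ t → segment x (P + t) n) (sym (m+[n∸m]≡n (<⇒≤ o<o'))) ⟩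
      segment x (P + (o + d)) n  ≡⟨ cong (λ t → segment x t n) (sym (+-assoc P o d)) ⟩
      segment x (P + o + d) n    ∎
      where open ≡-Reasoning

  -- Hence o ↦ ⌊o/h⌋ is injective on the admissible offsets, which lie below |σ^k|.
  offsets-count : ∀ w → LangSub σ w → length (offsets w) ≤ suc (M / h)
  offsets-count w w∈ = ≤-trans
    (pigeonhole (_/ h) (offsets w) (upTo (suc (M / h))) (filter⁺ (admissible? w) (upTo⁺ M)) into injective)
    (≤-reflexive (length-upTo (suc (M / h))))
    where
    into : ∀ o → o ∈ offsets w → o / h ∈ upTo (suc (M / h))
    into o o∈ = ∈-upTo⁺ (s≤s (/-monoˡ-≤ h (<⇒≤ (∈-upTo⁻ (proj₁ (∈-filter⁻ (admissible? w) {xs = upTo M} o∈))))))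
    injective : ∀ o o' → o ∈ offsets w → o' ∈ offsets w → o / h ≡ o' / h → o ≡ o'
    injective o o' o∈ o'∈ same with <-cmp o o'
    ... | tri< o<o' _ _ = ⊥-elim (offsets-spaced w w∈ o o' o∈ o'∈ o<o' same)
    ... | tri≈ _ o≡o' _ = o≡o'
    ... | tri> _ _ o>o' = ⊥-elim (offsets-spaced w w∈ o' o o'∈ o∈ o>o' (sym same))

  preimages-count : ∀ p c → IsComplexity σ (K + 1) p → IsCard (λ v → (φ ⋆ v ≡ u) × Lang y v) c →
                    c ≤ p * suc (M / h)
  preimages-count p c (ws , _ , ws⇔ , refl) (vs , unique-vs , vs⇔ , refl) = begin
    length vs                    ≤⟨ pigeonhole (λ v → v) vs (candidates ws) unique-vs into (λ _ _ _ _ eq → eq) ⟩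
    length (candidates ws)       ≤⟨ length-concatMap-≤ _ ws (suc (M / h)) count ⟩
    length ws * suc (M / h)      ∎
    where
    open ≤-Reasoning
    complete : ∀ w → length w ≡ K + 1 → LangSub σ w → w ∈ ws
    complete w len w∈ = Equivalence.from (ws⇔ w) (len , w∈)
    into : ∀ v → v ∈ vs → v ∈ candidates ws
    into v v∈ with Equivalence.to (vs⇔ v) v∈
    ... | φv≡u , v∈y = preimage-candidate ws complete v φv≡u v∈y
    count : ∀ w → w ∈ ws → length (map (extract w) (offsets w)) ≤ suc (M / h)
    count w w∈ = ≤-trans (≤-reflexive (length-map (extract w) (offsets w)))
                         (offsets-count w (proj₂ (Equivalence.to (ws⇔ w) w∈)))

open Embedding

-- Q ≥ 1, since the ratio bound at k = 0 reads |id| ≤ Q ⟨id⟩ with |id| = ⟨id⟩ = 1.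
ratio-≥1 : ∀ {m} (σ : Morphism (suc m) (suc m)) Q →
           (∀ k → ⟦ maxLen (σ ^[ k ]) ⟧ ℚ.≤ Q ℚ.* ⟦ minLen (σ ^[ k ]) ⟧) → ℚ.1ℚ ℚ.≤ Q
ratio-≥1 σ Q ratio = ℚP.≤-trans (⟦⟧-mono (maxLen-ub (σ ^[ 0 ]) Data.Fin.zero))
  (ℚP.≤-trans (ratio 0) (ℚP.≤-reflexive (trans (cong (λ t → Q ℚ.* ⟦ t ⟧) min≡1) (ℚP.*-identityʳ Q))))
  where
  min≡1 : minLen (σ ^[ 0 ]) ≡ 1
  min≡1 = ≤-antisym (minLen-lb (σ ^[ 0 ]) Data.Fin.zero) (minLen-glb (σ ^[ 0 ]) 1 (λ b → ≤-refl))

eventually-long : ∀ {m} (σ : Morphism (suc m) (suc m)) → IsGrowing σ → ∀ N → ∃[ k ] N ≤ minLen (σ ^[ k ])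
eventually-long σ growing N with growing N
... | k , large = k , minLen-glb (σ ^[ k ]) N (large k ≤-refl)

-- For k least with ⟨σ^k⟩ > n and n ≤ T h:  ⌊|σ^k|/h⌋ ≤ |σ| Q T.
-- If k = 0 this is trivial; otherwise |σ^k| ≤ |σ| |σ^{k-1}| ≤ |σ| Q ⟨σ^{k-1}⟩ ≤ |σ| Q n.
quotient-estimate : ∀ {m} (σ : Morphism (suc m) (suc m)) Q →
  (∀ k → ⟦ maxLen (σ ^[ k ]) ⟧ ℚ.≤ Q ℚ.* ⟦ minLen (σ ^[ k ]) ⟧) → 1 ≤ maxLen σ →
  ∀ n k h' T → 1 ≤ T → (∀ j → j < k → ¬ suc n ≤ minLen (σ ^[ j ])) → n ≤ T * suc h' →
  ⟦ maxLen (σ ^[ k ]) / suc h' ⟧ ℚ.≤ (⟦ maxLen σ ⟧ ℚ.* Q) ℚ.* ⟦ T ⟧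
quotient-estimate σ Q ratio |σ|≥1 n zero h' T T≥1 _ _ =
  ℚP.≤-trans (⟦⟧-mono (≤-trans (m/n≤m _ (suc h')) (≤-trans |id|≤1 T≥1)))
             (≤-scale ⟦ T ⟧ (≥1-* (⟦⟧-mono |σ|≥1) (ratio-≥1 σ Q ratio)) (⟦⟧-nonNeg T))
  where
  |id|≤1 : maxLen (σ ^[ 0 ]) ≤ 1
  |id|≤1 = maxLen-lub (σ ^[ 0 ]) 1 (λ b → ≤-refl)
quotient-estimate σ Q ratio |σ|≥1 n (suc k) h' T T≥1 shorterBefore n≤Th =
  ℚP.*-cancelʳ-≤-pos ⟦ suc h' ⟧ {{⟦suc⟧-pos h'}} (begin
    ⟦ D ⟧ ℚ.* ⟦ h ⟧                       ≡⟨ sym (⟦⟧-* D h) ⟩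
    ⟦ D * h ⟧                             ≤⟨ ⟦⟧-mono (≤-trans (m/n*n≤m M h) (maxLen-suc σ k)) ⟩
    ⟦ M' * S ⟧                            ≡⟨ ⟦⟧-* M' S ⟩
    ⟦ M' ⟧ ℚ.* ⟦ S ⟧                      ≤⟨ ℚP.*-monoʳ-≤-nonNeg ⟦ S ⟧ {{⟦⟧-nonNeg S}} (ratio k) ⟩
    (Q ℚ.* ⟦ m' ⟧) ℚ.* ⟦ S ⟧              ≤⟨ ℚP.*-monoʳ-≤-nonNeg ⟦ S ⟧ {{⟦⟧-nonNeg S}}
                                              (ℚP.*-monoˡ-≤-nonNeg Q {{≥1⇒nonNeg Q≥1}} (⟦⟧-mono m'≤Th)) ⟩
    (Q ℚ.* ⟦ T * h ⟧) ℚ.* ⟦ S ⟧           ≡⟨ cong (λ t → (Q ℚ.* t) ℚ.* ⟦ S ⟧) (⟦⟧-* T h) ⟩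
    (Q ℚ.* (⟦ T ⟧ ℚ.* ⟦ h ⟧)) ℚ.* ⟦ S ⟧   ≡⟨ rearrange Q ⟦ T ⟧ ⟦ h ⟧ ⟦ S ⟧ ⟩
    ((⟦ S ⟧ ℚ.* Q) ℚ.* ⟦ T ⟧) ℚ.* ⟦ h ⟧   ∎)
  where
  open ℚP.≤-Reasoning
  h = suc h'
  S = maxLen σ
  M = maxLen (σ ^[ suc k ])
  D = M / h
  M' = maxLen (σ ^[ k ])
  m' = minLen (σ ^[ k ])
  Q≥1 = ratio-≥1 σ Q ratio
  m'≤Th : m' ≤ T * h
  m'≤Th = ≤-trans (≤-pred (≰⇒> (shorterBefore k ≤-refl))) n≤Th
  rearrange : ∀ q t g s → (q ℚ.* (t ℚ.* g)) ℚ.* s ≡ ((s ℚ.* q) ℚ.* t) ℚ.* g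
  rearrange q t g s = begin-equality
    (q ℚ.* (t ℚ.* g)) ℚ.* s   ≡⟨ ℚP.*-comm _ s ⟩
    s ℚ.* (q ℚ.* (t ℚ.* g))   ≡⟨ sym (ℚP.*-assoc s q (t ℚ.* g)) ⟩
    (s ℚ.* q) ℚ.* (t ℚ.* g)   ≡⟨ sym (ℚP.*-assoc (s ℚ.* q) t g) ⟩
    ((s ℚ.* q) ℚ.* t) ℚ.* g   ∎

final-estimate : ∀ S Q c p D T R → 1 ≤ S → ℚ.1ℚ ℚ.≤ Q → c ≤ p * suc D →
  ⟦ D ⟧ ℚ.≤ (⟦ S ⟧ ℚ.* Q) ℚ.* ⟦ T ⟧ → 1 + T ≤ R → ⟦ c ⟧ ℚ.≤ ⟦ p ⟧ ℚ.* ⟦ S ⟧ ℚ.* Q ℚ.* ⟦ R ⟧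
final-estimate S Q c p D T R S≥1 Q≥1 c≤ D≤ T<R = begin
  ⟦ c ⟧                                    ≤⟨ ⟦⟧-mono c≤ ⟩
  ⟦ p * suc D ⟧                            ≡⟨ ⟦⟧-* p (suc D) ⟩
  ⟦ p ⟧ ℚ.* ⟦ suc D ⟧                      ≤⟨ ℚP.*-monoˡ-≤-nonNeg ⟦ p ⟧ {{⟦⟧-nonNeg p}} D+1≤ ⟩
  ⟦ p ⟧ ℚ.* ((⟦ S ⟧ ℚ.* Q) ℚ.* ⟦ R ⟧)      ≡⟨ sym (ℚP.*-assoc ⟦ p ⟧ _ _) ⟩
  (⟦ p ⟧ ℚ.* (⟦ S ⟧ ℚ.* Q)) ℚ.* ⟦ R ⟧      ≡⟨ cong (ℚ._* ⟦ R ⟧) (sym (ℚP.*-assoc ⟦ p ⟧ _ _)) ⟩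
  ⟦ p ⟧ ℚ.* ⟦ S ⟧ ℚ.* Q ℚ.* ⟦ R ⟧          ∎
  where
  open ℚP.≤-Reasoning
  SQ≥1 : ℚ.1ℚ ℚ.≤ ⟦ S ⟧ ℚ.* Q
  SQ≥1 = ≥1-* (⟦⟧-mono S≥1) Q≥1
  D+1≤ : ⟦ suc D ⟧ ℚ.≤ (⟦ S ⟧ ℚ.* Q) ℚ.* ⟦ R ⟧
  D+1≤ = ℚP.≤-trans (≤-suc-scaled D T SQ≥1 D≤)
    (ℚP.*-monoˡ-≤-nonNeg (⟦ S ⟧ ℚ.* Q) {{ℚP.nonNeg*nonNeg⇒nonNeg ⟦ S ⟧ {{⟦⟧-nonNeg S}} Q {{≥1⇒nonNeg Q≥1}}}} (⟦⟧-mono T<R))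

proposition26 :
  ∀ {m l : ℕ} (φ : Morphism (suc m) l) (σ : Morphism (suc m) (suc m)) (a : Fin (suc m)) →
  IsCoding φ →
  IsSubstitution σ a →
  (∀ b → HasGrowthType σ b) →
  (y : ℕ → Fin (suc m)) → IsFixedPointLimit σ a y →
  (∀ b → ∃[ i ] y i ≡ b) →
  (x : ℕ → Fin l) → (∀ i → φ (y i) ≡ x i ∷ []) →
  IsUniformlyRecurrent x → ¬ IsUltimatelyPeriodic x →
  (K : ℕ) → 1 ≤ K → IsLinearlyRecurrent x K →
  (Q : ℚ) → (∀ k → fromℕℚ (maxLen (σ ^[ k ])) ℚ.≤ Q ℚ.* fromℕℚ (minLen (σ ^[ k ]))) →
  (p : ℕ) → IsComplexity σ (K + 1) p →
  ∀ u → Lang x u →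
  ∀ c → IsCard (λ v → (φ ⋆ v ≡ u) × Lang y v) c →
  fromℕℚ c ℚ.≤ fromℕℚ p ℚ.* fromℕℚ (maxLen σ) ℚ.* Q ℚ.* fromℕℚ ((K + 1) * (K + 1))
proposition26 _ _ _ _ _ _ _ _ _ _ _ _ _ zero () _ _ _ _ _ _ _ _ _
proposition26 φ σ a (letterwise , _) (growing , _ , _ , σa≡) _ y fixedPoint occurs x x≡φy _ aperiodic
              (suc K') _ linRec Q ratio p complexity u _ c preimages
  with eventually-long σ growing (suc (length u))
... | N , longN with leastWitness (λ k → suc (length u) ≤? minLen (σ ^[ k ])) N longN
                   | spacingLength (length u) K'
... | k , long , shorterBefore | h' , n≤2Kh , spaced =
  final-estimate (maxLen σ) Q c p (maxLen (σ ^[ k ]) / suc h') (K + K) ((K + 1) * (K + 1)) |σ|≥1 (ratio-≥1 σ Q ratio)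
    (Counting.preimages-count φ σ a letterwise growing y fixedPoint occurs x x≡φy aperiodic
                              K' linRec u k long h' spaced p c complexity preimages)
    (quotient-estimate σ Q ratio |σ|≥1 (length u) k h' (K + K) (≤-trans (s≤s z≤n) (m≤m+n K K)) shorterBefore
                       (≤-trans n≤2Kh (≤-reflexive (sym (*-distribʳ-+ (suc h') K K)))))
    2K+1≤[K+1]²
  where
  K = suc K'
  -- σ(a) = a u is nonempty
  |σ|≥1 : 1 ≤ maxLen σ
  |σ|≥1 = ≤-trans (s≤s z≤n) (≤-trans (≤-reflexive (cong length (sym σa≡))) (maxLen-ub σ a))
  2K+1≤[K+1]² : 1 + (K + K) ≤ (K + 1) * (K + 1)
  2K+1≤[K+1]² = ≤-trans (m≤m+n (1 + (K + K)) (K * K)) (≤-reflexive (sym (square K)))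
    where
    square : ∀ j → (j + 1) * (j + 1) ≡ 1 + (j + j) + j * j
    square = solve-∀
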